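{- Let $A$ be any type. Let $\Pi(A)$ be the structure whose objects are the terms $a : A$ and whose morphisms from $a$ to $b$ are the computational paths from $a$ to $b$, with composition $s \circ t := \tau(t,s)$ (for $t$ a path from $a$ to $b$ and $s$ a path from $b$ to $c$) and identity on $a$ the reflexive path $\rho_a$. Then $\Pi(A)$ is a weak groupoid: the associativity and identity laws of a category hold up to $rw$-equality, and every morphism $s$ has an inverse (namely $\sigma(s)$) up to $rw$-equality, i.e. $s \circ \sigma(s) =_{rw} \rho_b$ and $\sigma(s) \circ s =_{rw} \rho_a$ for $s$ a path from $a$ to $b$.
   Context: Equality theory of type theory: judgements $M = N : A$ are generated by the rules $\rho$ (reflexivity: from $M:A$ infer $M=M:A$), $\sigma$ (symmetry), $\tau$ (transitivity: from $M=N:A$ and $N=P:A$ infer $M=P:A$), together with type-specific rules such as, for $\Pi$-types, $\beta$, $\eta$, $\xi$, $\mu$, $\nu$ (congruence and computation rules, as in $\lambda\beta\eta$-equality), considered modulo change of bound variables. A computational path $s$ from $a$ to $b$ (written $a =_s b$) is a term recording a composition (via $\tau$) of applications of these rules deriving $a = b : A$; e.g. $\rho_a$ is a path from $a$ to $a$, $\sigma(s)$ is a path from $b$ to $a$, and $\tau(s,t)$ is a path from $a$ to $c$ when $s$ goes from $a$ to $b$ and $t$ from $b$ to $c$. Paths are rewritten by the term rewriting system $LND_{EQ}$-$TRS$, which includes among its rules: $\sigma(\rho) \rhd_{sr} \rho$, $\sigma(\sigma(r)) \rhd_{ss} r$, $\tau(r,\sigma(r)) \rhd_{tr} \rho$,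 $\tau(\sigma(r),r) \rhd_{tsr} \rho$, $\tau(r,\rho) \rhd_{trr} r$, $\tau(\rho,r) \rhd_{tlr} r$, $\tau(\tau(t,r),s) \rhd_{tt} \tau(t,\tau(r,s))$. We write $s \rhd_{1rw} t$ if $t$ is obtained from $s$ by one application of a rewrite rule, and $s =_{rw} t$ ($rw$-equality) if there is a finite sequence $s \equiv R_0, \dots, R_n \equiv t$ with $R_i \rhd_{1rw} R_{i+1}$ or $R_{i+1} \rhd_{1rw} R_i$ for each $i$; this is an equivalence relation. A structure is "weak" if the required equations hold only up to $rw$-equality rather than syntactically. -}

module Defs where

open import Relation.Binary.Construct.Closure.Equivalence using (EqClosure)

-- Computational paths over a type A.
-- `Step a b` stands for the applications of the type-specific equality
-- rules (β, η, ξ, μ, ν, ...) deriving a = b : A; the path terms record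
-- compositions of these with the structural rules ρ, σ, τ.
module Paths {A : Set} (Step : A → A → Set) where

  data Path : A → A → Set where
    ρ    : {a : A} → Path a a
    σ    : {a b : A} → Path a b → Path b a
    τ    : {a b c : A} → Path a b → Path b c → Path a c
    rule : {a b : A} → Step a b → Path a b

  infix 4 _▷1rw_
  data _▷1rw_ : {a b : A} → Path a b → Path a b → Set where
    sr  : {a : A} → σ (ρ {a}) ▷1rw ρ
    ss  : {a b : A} (r : Path a b) → σ (σ r) ▷1rw r
    tr  : {a b : A} (r : Path a b) → τ r (σ r) ▷1rw ρ
    tsr : {a b : A} (r : Path a b) → τ (σ r) r ▷1rw ρ
    trr : {a b : A} (r : Path a b) → τ r ρ ▷1rw r
    tlr : {a b : A} (r : Path a b) → τ ρ r ▷1rw r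
    tt  : {a b c d : A} (t : Path a b) (r : Path b c) (s : Path c d) →
          τ (τ t r) s ▷1rw τ t (τ r s)
    cσ  : {a b : A} {r r' : Path a b} → r ▷1rw r' → σ r ▷1rw σ r'
    cτˡ : {a b c : A} {r r' : Path a b} (s : Path b c) →
          r ▷1rw r' → τ r s ▷1rw τ r' s
    cτʳ : {a b c : A} (r : Path a b) {s s' : Path b c} →
          s ▷1rw s' → τ r s ▷1rw τ r s'

  infix 4 _=rw_
  _=rw_ : {a b : A} → Path a b → Path a b → Set
  _=rw_ {a} {b} = EqClosure (_▷1rw_ {a} {b})

  infixr 9 _∘_
  _∘_ : {a b c : A} → Path b c → Path a b → Path a c
  s ∘ t = τ t s

  id : (a : A) → Path a a
  id a = ρ

  record IsWeakGroupoid : Set where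
    field
      assoc     : {a b c d : A} (t : Path a b) (s : Path b c) (r : Path c d) →
                  (r ∘ s) ∘ t =rw r ∘ (s ∘ t)
      identityˡ : {a b : A} (s : Path a b) → id b ∘ s =rw s
      identityʳ : {a b : A} (s : Path a b) → s ∘ id a =rw s
      inverseʳ  : {a b : A} (s : Path a b) → s ∘ σ s =rw id b
      inverseˡ  : {a b : A} (s : Path a b) → σ s ∘ s =rw id a

module Submission where

-- Every law is witnessed by a SINGLE rule of LND_EQ-TRS applied at the root:
--   associativity    (r ∘ s) ∘ t = τ t (τ s r)  ◁tt  τ (τ t s) r = r ∘ (s ∘ t)
--   left identity    ρ ∘ s       = τ s ρ         ▷trr s
--   right identity   s ∘ ρ       = τ ρ s         ▷tlr s
--   right inverse    s ∘ σ s     = τ (σ s) s     ▷tsr ρ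
--   left inverse     σ s ∘ s     = τ s (σ s)     ▷tr  ρ
-- Since rw-equality is the equivalence closure of ▷1rw, a rewrite step
-- yields an rw-equality in either direction ('step' and 'step⁻¹' below);
-- associativity is the only law that uses a rule backwards.

open import Defs
open import Relation.Binary.Construct.Closure.Equivalence using (return; symmetric)

module _ {A : Set} (Step : A → A → Set) where
  open Paths Step

  step : {a b : A} {s t : Path a b} → s ▷1rw t → s =rw t
  step = return

  step⁻¹ : {a b : A} {s t : Path a b} → t ▷1rw s → s =rw t
  step⁻¹ r = symmetric _▷1rw_ (return r)

  ∘-assoc : {a b c d : A} (t : Path a b) (s : Path b c) (r : Path c d) →
            (r ∘ s) ∘ t =rw r ∘ (s ∘ t)
  ∘-assoc t s r = step⁻¹ (tt t s r)

  ∘-identityˡ : {a b : A} (s : Path a b) → id b ∘ s =rw s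
  ∘-identityˡ s = step (trr s)

  ∘-identityʳ : {a b : A} (s : Path a b) → s ∘ id a =rw s
  ∘-identityʳ s = step (tlr s)

  ∘-inverseʳ : {a b : A} (s : Path a b) → s ∘ σ s =rw id b
  ∘-inverseʳ s = step (tsr s)

  ∘-inverseˡ : {a b : A} (s : Path a b) → σ s ∘ s =rw id a
  ∘-inverseˡ s = step (tr s)

proposition4p1 : (A : Set) (Step : A → A → Set) → Paths.IsWeakGroupoid Step
proposition4p1 A Step = record
  { assoc     = ∘-assoc Step
  ; identityˡ = ∘-identityˡ Step
  ; identityʳ = ∘-identityʳ Step
  ; inverseʳ  = ∘-inverseʳ Step
  ; inverseˡ  = ∘-inverseˡ Step
  }
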